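{- Let $k \geq 3$, let $H$ be a finite $k$-uniform hypergraph and let $M$ be a maximum $(k-1)$-matching in $H$. If there exists $e \in M$ such that $\tau^{(k-1)}(T_e) \leq \lceil \frac{k+1}{2} \rceil$, then $$\tau^{(k-1)}(H) \leq \left\lceil \frac{k+1}{2}\right\rceil + \left(\nu^{(k-1)}(H) - 1\right) g_{\nu^{(k-1)}(H)-1}(k, k-1).$$
   Context: For a $k$-uniform hypergraph $H$ with vertex set $V$: a $(k-1)$-matching is a set $M$ of edges with $|e \cap e'| < k-1$ for all distinct $e,e' \in M$, and $\nu^{(k-1)}(H)$ is its maximum size. A $(k-1)$-cover is a set $C$ of $(k-1)$-subsets of $V$ such that every edge contains a member of $C$; $\tau^{(k-1)}(H)$ is the minimum size. For a set $F$ of edges, $\tau^{(k-1)}(F)$ refers to the hypergraph with edge set $F$. For $e \in M$, $T_e = \{h \in E(H) : |e \cap h| \geq k-1\}$. For $i \ge 1$, $g_i(k,m)$ is the supremum of $\tau^{(m)}(H')/\nu^{(m)}(H')$ over all finite $k$-uniform hypergraphs $H'$ with $\nu^{(m)}(H') = i$. -}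

module Defs where

open import Data.Nat as ℕ using (ℕ; zero; suc; _∸_; _<_; _≤_; _≤?_)
open import Data.Integer using (+_)
open import Data.Rational as ℚ using (ℚ; _/_)
open import Data.Fin.Subset using (Subset; _∩_; _⊆_; ∣_∣)
open import Data.List using (List; length; filter)
open import Data.List.Membership.Propositional using (_∈_)
open import Data.List.Relation.Unary.All using (All)
open import Data.List.Relation.Unary.Unique.Propositional using (Unique)
open import Data.Product using (Σ; _×_; ∃)
open import Data.Empty using (⊥)
open import Relation.Binary.PropositionalEquality using (_≡_; _≢_)

record Hypergraph (n : ℕ) : Set where
  constructor hypergraph
  field
    edges  : List (Subset n)
    unique : Unique edges
open Hypergraph public

Uniform : ∀ {n} → ℕ → Hypergraph n → Set
Uniform k H = All (λ e → ∣ e ∣ ≡ k) (edges H)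

IsMatching : ∀ {n} → ℕ → Hypergraph n → List (Subset n) → Set
IsMatching k H M =
  All (λ e → e ∈ edges H) M × Unique M ×
  (∀ {e e'} → e ∈ M → e' ∈ M → e ≢ e' → ∣ e ∩ e' ∣ < k ∸ 1)

IsMaxMatching : ∀ {n} → ℕ → Hypergraph n → List (Subset n) → Set
IsMaxMatching k H M =
  IsMatching k H M × (∀ M' → IsMatching k H M' → length M' ≤ length M)

IsNu : ∀ {n} → ℕ → Hypergraph n → ℕ → Set
IsNu k H m = Σ (List _) λ M → IsMaxMatching k H M × length M ≡ m

IsCover : ∀ {n} → ℕ → List (Subset n) → List (Subset n) → Set
IsCover k F C =
  All (λ c → ∣ c ∣ ≡ k ∸ 1) C × Unique C ×
  (∀ {h} → h ∈ F → ∃ λ c → c ∈ C × c ⊆ h)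

IsTau : ∀ {n} → ℕ → List (Subset n) → ℕ → Set
IsTau k F t =
  Σ (List _) λ C → IsCover k F C × length C ≡ t × (∀ C' → IsCover k F C' → t ≤ length C')

T : ∀ {n} → ℕ → Hypergraph n → Subset n → List (Subset n)
T k H e = filter (λ h → (k ∸ 1) ≤? ∣ e ∩ h ∣) (edges H)

-- IsG k i g : g = g_i(k, k-1), the supremum of τ^{(k-1)}(H')/ν^{(k-1)}(H') over all
-- finite k-uniform H' with ν^{(k-1)}(H') = i  (only defined for i ≥ 1).
IsUpperG : ℕ → ℕ → ℚ → Set
IsUpperG k zero b = ⊥
IsUpperG k (suc j) b =
  ∀ (n' : ℕ) (H' : Hypergraph n') (t : ℕ) → Uniform k H' → IsNu k H' (suc j) → IsTau k (edges H') t →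
  (+ t / suc j) ℚ.≤ b

IsG : ℕ → ℕ → ℚ → Set
IsG k i g = IsUpperG k i g × (∀ b → IsUpperG k i b → g ℚ.≤ b)

toℚ : ℕ → ℚ
toℚ m = + m / 1

-- Every edge of H ∖ T_e meets e in fewer than k - 1 vertices, so e extends any (k-1)-matching of
-- H ∖ T_e, while M minus e is one; hence ν(H ∖ T_e) = ν(H) - 1 and
-- τ(H ∖ T_e) ≤ (ν(H) - 1) g_{ν(H)-1}(k, k-1). Covers of T_e and of H ∖ T_e together cover H.
-- A minimum cover of H ∖ T_e exists only under double negation, which suffices because the
-- conclusion is a decidable inequality of rationals.
module Submission where

open import Defs
open import Data.Nat using (ℕ; _≤_; _∸_; ⌈_/2⌉; suc)
open import Data.Rational as ℚ using (ℚ; _+_; _*_)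
open import Data.Fin.Subset using (Subset)
open import Data.List using (List)
open import Data.List.Membership.Propositional using (_∈_)
open import Data.Sum using (_⊎_)
open import Relation.Binary.PropositionalEquality using (_≡_)

import Data.Bool as Bool
open import Data.Fin.Subset using (_∩_; _⊆_; ∣_∣)
open import Data.Fin.Subset.Properties using (∩-idem; ∩-comm)
open import Data.Integer as ℤ using (+_; +≤+)
import Data.Integer.Properties as ℤP
open import Data.List using ([]; _∷_; [_]; _++_; length; filter; deduplicate)
open import Data.List.Membership.Propositional.Properties
  using (∈-filter⁺; ∈-filter⁻; ∈-++⁺ˡ; ∈-++⁺ʳ; ∈-deduplicate⁺)
open import Data.List.Properties using (length-++; length-deduplicate; filter-all)
open import Data.List.Relation.Binary.Subset.Propositional using () renaming (_⊆_ to _⊆ᴸ_)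
open import Data.List.Relation.Binary.Subset.Propositional.Properties using (filter-⊆)
open import Data.List.Relation.Unary.All as All using (All; []; _∷_)
import Data.List.Relation.Unary.All.Properties as All
open import Data.List.Relation.Unary.AllPairs using ([]; _∷_)
open import Data.List.Relation.Unary.Any using (here; there)
open import Data.List.Relation.Unary.Unique.Propositional using (Unique)
import Data.List.Relation.Unary.Unique.Propositional.Properties as Unique
open import Data.List.Relation.Unary.Unique.DecPropositional.Properties using (deduplicate-!)
open import Data.Nat as ℕ using (zero; _<_; _<?_; _≤?_; z≤n; s≤s)
open import Data.Nat.Induction using (<-rec)
import Data.Nat.Properties as ℕP
open import Data.Product using (_×_; _,_; proj₁; proj₂; ∃)
import Data.Rational.Properties as ℚP
open import Data.Rational.Unnormalised as ℚᵘ using (mkℚᵘ; *≤*)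
import Data.Rational.Unnormalised.Properties as ℚᵘP
open import Data.Sum using (inj₁; inj₂)
open import Data.Vec.Properties using (≡-dec)
open import Level using (Level)
open import Relation.Binary.Definitions using (DecidableEquality)
open import Relation.Binary.PropositionalEquality using (_≢_; refl; sym; trans; cong; cong₂; subst)
open import Relation.Nullary using (¬_; yes; no; contradiction)
open import Relation.Nullary.Decidable using (decidable-stable)
open import Relation.Nullary.Negation using (¬¬-map)
open import Relation.Unary using (Pred; Decidable)
open import Function using (_∘_)

private
  variable
    a ℓ : Level
    A : Set a
    k m n : ℕ
    H : Hypergraph n
    e h : Subset n
    F F₁ F₂ C C₁ C₂ M : List (Subset n)

toℚᵘ-toℚ : ∀ m → ℚ.toℚᵘ (toℚ m) ℚᵘ.≃ mkℚᵘ (+ m) 0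
toℚᵘ-toℚ m = ℚP.toℚᵘ-fromℚᵘ (mkℚᵘ (+ m) 0)

toℚ-mono-≤ : m ≤ n → toℚ m ℚ.≤ toℚ n
toℚ-mono-≤ {m} {n} m≤n = ℚP.toℚᵘ-cancel-≤ (begin
  ℚ.toℚᵘ (toℚ m) ≃⟨ toℚᵘ-toℚ m ⟩
  mkℚᵘ (+ m) 0   ≤⟨ *≤* (ℤP.*-monoʳ-≤-nonNeg (+ 1) (+≤+ m≤n)) ⟩
  mkℚᵘ (+ n) 0   ≃⟨ ℚᵘP.≃-sym (toℚᵘ-toℚ n) ⟩
  ℚ.toℚᵘ (toℚ n) ∎)
  where open ℚᵘP.≤-Reasoning

toℚ-homo-+ : ∀ m n → toℚ (m ℕ.+ n) ≡ toℚ m + toℚ n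
toℚ-homo-+ m n = ℚP.toℚᵘ-injective (begin-equality
  ℚ.toℚᵘ (toℚ (m ℕ.+ n))                   ≃⟨ toℚᵘ-toℚ (m ℕ.+ n) ⟩
  mkℚᵘ (+ (m ℕ.+ n)) 0                     ≡⟨ cong (λ i → mkℚᵘ i 0) numerators ⟩
  mkℚᵘ (+ m) 0 ℚᵘ.+ mkℚᵘ (+ n) 0           ≃⟨ ℚᵘP.+-cong (ℚᵘP.≃-sym (toℚᵘ-toℚ m)) (ℚᵘP.≃-sym (toℚᵘ-toℚ n)) ⟩
  ℚ.toℚᵘ (toℚ m) ℚᵘ.+ ℚ.toℚᵘ (toℚ n)       ≃⟨ ℚP.toℚᵘ-homo-+ (toℚ m) (toℚ n) ⟨
  ℚ.toℚᵘ (toℚ m + toℚ n)                   ∎)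
  where
  open ℚᵘP.≤-Reasoning
  numerators : + (m ℕ.+ n) ≡ + m ℤ.* + 1 ℤ.+ + n ℤ.* + 1
  numerators = trans (ℤP.pos-+ m n) (sym (cong₂ ℤ._+_ (ℤP.*-identityʳ (+ m)) (ℤP.*-identityʳ (+ n))))

d*[a/d]≡a : ∀ a d → toℚ (suc d) * (+ a ℚ./ suc d) ≡ toℚ a
d*[a/d]≡a a d = ℚP.toℚᵘ-injective (begin-equality
  ℚ.toℚᵘ (toℚ (suc d) * (+ a ℚ./ suc d))                ≃⟨ ℚP.toℚᵘ-homo-* (toℚ (suc d)) (+ a ℚ./ suc d) ⟩
  ℚ.toℚᵘ (toℚ (suc d)) ℚᵘ.* ℚ.toℚᵘ (+ a ℚ./ suc d)      ≃⟨ ℚᵘP.*-cong (toℚᵘ-toℚ (suc d)) (ℚP.toℚᵘ-fromℚᵘ (mkℚᵘ (+ a) d)) ⟩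
  (+ suc d ℤ.* + a) ℚᵘ./ (1 ℕ.* suc d)                  ≡⟨ ℚᵘP./-cong refl (ℕP.*-comm 1 (suc d)) ⟩
  (+ suc d ℤ.* + a) ℚᵘ./ (suc d ℕ.* 1)                  ≃⟨ ℚᵘP.*-cancelˡ-/ (suc d) ⟩
  mkℚᵘ (+ a) 0                                          ≃⟨ toℚᵘ-toℚ a ⟨
  ℚ.toℚᵘ (toℚ a)                                        ∎)
  where open ℚᵘP.≤-Reasoning

/≤⇒≤* : ∀ a d {g} → + a ℚ./ suc d ℚ.≤ g → toℚ a ℚ.≤ toℚ (suc d) * g
/≤⇒≤* a d {g} a/d≤g = begin
  toℚ a                           ≡⟨ d*[a/d]≡a a d ⟨
  toℚ (suc d) * (+ a ℚ./ suc d)   ≤⟨ ℚP.*-monoˡ-≤-nonNeg (toℚ (suc d)) a/d≤g ⟩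
  toℚ (suc d) * g                 ∎
  where
  open ℚP.≤-Reasoning
  instance
    _ : ℚ.NonNegative (toℚ (suc d))
    _ = ℚP.normalize-nonNeg (suc d) 1

¬¬-least : (P : Pred ℕ ℓ) → P n → ¬ ¬ ∃ λ m → P m × (∀ {m′} → P m′ → m ≤ m′)
¬¬-least {n = n} P Pn ¬least = <-rec (λ n → ¬ P n) not-below n Pn
  where
  not-below : ∀ n → (∀ {m} → m < n → ¬ P m) → ¬ P n
  not-below n below Pn = ¬least (n , Pn , λ Pm′ → ℕP.≮⇒≥ (λ m′<n → below m′<n Pm′))

_≟ˢ_ : DecidableEquality (Subset n)
_≟ˢ_ = ≡-dec Bool._≟_

cover-⊆ : F ⊆ᴸ F₁ → IsCover k F₁ C → IsCover k F C
cover-⊆ F⊆F₁ (sizes , unique , covers) = sizes , unique , λ h∈F → covers (F⊆F₁ h∈F)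

cover-∪ : (∀ {h} → h ∈ F → h ∈ F₁ ⊎ h ∈ F₂) → IsCover k F₁ C₁ → IsCover k F₂ C₂ →
          ∃ λ C → IsCover k F C × length C ≤ length C₁ ℕ.+ length C₂
cover-∪ {F = F} {C₁ = C₁} {C₂ = C₂} split (sizes₁ , _ , covers₁) (sizes₂ , _ , covers₂) =
  C₁∪C₂ , (All.deduplicate⁺ _≟ˢ_ (All.++⁺ sizes₁ sizes₂) , deduplicate-! _≟ˢ_ (C₁ ++ C₂) , covers) ,
  subst (length C₁∪C₂ ≤_) (length-++ C₁) (length-deduplicate _≟ˢ_ (C₁ ++ C₂))
  where
  C₁∪C₂ : List (Subset _)
  C₁∪C₂ = deduplicate _≟ˢ_ (C₁ ++ C₂)
  covers : ∀ {h} → h ∈ F → ∃ λ c → c ∈ C₁∪C₂ × c ⊆ h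
  covers h∈F with split h∈F
  ... | inj₁ h∈F₁ = let c , c∈C₁ , c⊆h = covers₁ h∈F₁ in c , ∈-deduplicate⁺ _≟ˢ_ (∈-++⁺ˡ c∈C₁) , c⊆h
  ... | inj₂ h∈F₂ = let c , c∈C₂ , c⊆h = covers₂ h∈F₂ in c , ∈-deduplicate⁺ _≟ˢ_ (∈-++⁺ʳ C₁ c∈C₂) , c⊆h

τ-subadditive : ∀ {τ t₁ t₂} → (∀ {h} → h ∈ F → h ∈ F₁ ⊎ h ∈ F₂) →
                IsTau k F τ → IsTau k F₁ t₁ → IsTau k F₂ t₂ → τ ≤ t₁ ℕ.+ t₂
τ-subadditive {k = k} split (_ , _ , _ , minimal) (_ , cover₁ , refl , _) (_ , cover₂ , refl , _) =
  let C , cover , |C|≤ = cover-∪ {k = k} split cover₁ cover₂ in ℕP.≤-trans (minimal C cover) |C|≤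

¬¬∃τ : IsCover k F C → ¬ ¬ ∃ (IsTau k F)
¬¬∃τ {k = k} {F = F} {C = C} cover = ¬¬-map to-τ (¬¬-least CoverOfSize (C , cover , refl))
  where
  CoverOfSize : ℕ → Set
  CoverOfSize t = ∃ λ C′ → IsCover k F C′ × length C′ ≡ t
  to-τ : (∃ λ t → CoverOfSize t × (∀ {t′} → CoverOfSize t′ → t ≤ t′)) → ∃ (IsTau k F)
  to-τ (t , (C′ , cover′ , refl) , least) = t , C′ , cover′ , refl , λ C″ cover″ → least (C″ , cover″ , refl)

length≤suc-filter : ∀ {P : Pred A ℓ} (P? : Decidable P) {x} {xs} → Unique xs →
                    (∀ {y} → y ∈ xs → y ≢ x → P y) → length xs ≤ suc (length (filter P? xs))
length≤suc-filter P? {xs = []}     _                  _      = z≤n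
length≤suc-filter {P = P} P? {x} {y ∷ xs} (y∉xs ∷ xs-unique) P-off-x with P? y
... | yes _  = s≤s (length≤suc-filter P? xs-unique (λ z∈xs → P-off-x (there z∈xs)))
... | no ¬Py = s≤s (ℕP.≤-reflexive (cong length (sym (filter-all P? (All.tabulate P-rest)))))
  where
  P-rest : ∀ {z} → z ∈ xs → P z
  P-rest z∈xs = P-off-x (there z∈xs) λ z≡x →
    ¬Py (P-off-x (here refl) λ y≡x → All.lookup y∉xs z∈xs (trans y≡x (sym z≡x)))

singleton-matching : h ∈ edges H → IsMatching k H [ h ]
singleton-matching h∈H = h∈H ∷ [] , [] ∷ [] , λ { (here refl) (here refl) h≢h → contradiction refl h≢h }

ν≡0⇒τ≡0 : IsNu k H 0 → IsTau k (edges H) 0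
ν≡0⇒τ≡0 {k = k} {H = H} (M , (_ , maximum) , |M|≡0) = [] , ([] , [] , noEdge) , refl , λ _ _ → z≤n
  where
  noEdge : ∀ {h} → h ∈ edges H → ∃ λ c → c ∈ [] × c ⊆ h
  noEdge {h} h∈H = contradiction (subst (1 ≤_) |M|≡0 (maximum [ h ] (singleton-matching {H = H} {k = k} h∈H))) λ ()

ν-unique : ∀ {ν} → IsNu k H ν → IsMaxMatching k H M → length M ≡ ν
ν-unique {M = M} (M₀ , (M₀-matching , M₀-maximum) , refl) (M-matching , M-maximum) =
  ℕP.≤-antisym (M₀-maximum M M-matching) (M-maximum M₀ M₀-matching)

module RemoveT (k : ℕ) (H : Hypergraph n) (e : Subset n) where

  Far : Subset n → Set
  Far h = ∣ e ∩ h ∣ < k ∸ 1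

  far? : Decidable Far
  far? h = ∣ e ∩ h ∣ <? k ∸ 1

  H∖T : Hypergraph n
  H∖T = hypergraph (filter far? (edges H)) (Unique.filter⁺ far? (unique H))

  H∖T-uniform : Uniform k H → Uniform k H∖T
  H∖T-uniform = All.filter⁺ far?

  ∈-H∖T⁻ : h ∈ edges H∖T → h ∈ edges H × Far h
  ∈-H∖T⁻ = ∈-filter⁻ far?

  ∈-T⊎H∖T : h ∈ edges H → h ∈ T k H e ⊎ h ∈ edges H∖T
  ∈-T⊎H∖T {h = h} h∈H with k ∸ 1 ≤? ∣ e ∩ h ∣
  ... | yes near = inj₁ (∈-filter⁺ (λ h → k ∸ 1 ≤? ∣ e ∩ h ∣) h∈H near)
  ... | no ¬near = inj₂ (∈-filter⁺ far? h∈H (ℕP.≰⇒> ¬near))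

  ¬Far-self : ∣ e ∣ ≡ k → ¬ Far e
  ¬Far-self ∣e∣≡k e-far = ℕP.<⇒≱ e-far (begin
    k ∸ 1       ≤⟨ ℕP.m∸n≤m k 1 ⟩
    k           ≡⟨ ∣e∣≡k ⟨
    ∣ e ∣       ≡⟨ cong ∣_∣ (∩-idem e) ⟨
    ∣ e ∩ e ∣   ∎)
    where open ℕP.≤-Reasoning

  ∷-matching : e ∈ edges H → ∣ e ∣ ≡ k → IsMatching k H∖T M → IsMatching k H (e ∷ M)
  ∷-matching {M = M} e∈H ∣e∣≡k (M⊆ , M-unique , M-sparse) =
    e∈H ∷ All.map (proj₁ ∘ ∈-H∖T⁻) M⊆ , All.map e≢ M⊆ ∷ M-unique , sparse
    where
    far : ∀ {h} → h ∈ M → Far h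
    far h∈M = proj₂ (∈-H∖T⁻ (All.lookup M⊆ h∈M))
    e≢ : ∀ {h} → h ∈ edges H∖T → e ≢ h
    e≢ h∈ refl = ¬Far-self ∣e∣≡k (proj₂ (∈-H∖T⁻ h∈))
    sparse : ∀ {x y} → x ∈ e ∷ M → y ∈ e ∷ M → x ≢ y → ∣ x ∩ y ∣ < k ∸ 1
    sparse (here refl)  (here refl)  x≢y = contradiction refl x≢y
    sparse (here refl)  (there y∈M)  _   = far y∈M
    sparse (there x∈M)  (here refl)  _   = subst (_< k ∸ 1) (cong ∣_∣ (∩-comm e _)) (far x∈M)
    sparse (there x∈M)  (there y∈M)  x≢y = M-sparse x∈M y∈M x≢y

  filter-far-matching : IsMatching k H M → IsMatching k H∖T (filter far? M)
  filter-far-matching {M = M} (M⊆ , M-unique , M-sparse) =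
    All.tabulate ∈-H∖T⁺ , Unique.filter⁺ far? M-unique ,
    λ x∈ y∈ → M-sparse (filter-⊆ far? M x∈) (filter-⊆ far? M y∈)
    where
    ∈-H∖T⁺ : ∀ {h} → h ∈ filter far? M → h ∈ edges H∖T
    ∈-H∖T⁺ h∈ = let h∈M , h-far = ∈-filter⁻ far? h∈ in ∈-filter⁺ far? (All.lookup M⊆ h∈M) h-far

  ν-H∖T : ∣ e ∣ ≡ k → IsMaxMatching k H M → e ∈ M → IsNu k H∖T (length M ∸ 1)
  ν-H∖T {M = M} ∣e∣≡k (M-matching@(M⊆ , M-unique , M-sparse) , M-maximum) e∈M =
    filter far? M , (filter-far-matching M-matching , maximum) , length-filter-far
    where
    fits : ∀ M′ → IsMatching k H∖T M′ → length M′ ≤ length M ∸ 1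
    fits M′ M′-matching =
      ℕP.∸-monoˡ-≤ 1 (M-maximum (e ∷ M′) (∷-matching (All.lookup M⊆ e∈M) ∣e∣≡k M′-matching))
    only-e-near : length M ≤ suc (length (filter far? M))
    only-e-near = length≤suc-filter far? M-unique λ {h} h∈M h≢e →
      subst (_< k ∸ 1) (cong ∣_∣ (∩-comm h e)) (M-sparse h∈M e∈M h≢e)
    length-filter-far : length (filter far? M) ≡ length M ∸ 1
    length-filter-far = ℕP.≤-antisym (fits _ (filter-far-matching M-matching)) (ℕP.∸-monoˡ-≤ 1 only-e-near)
    maximum : ∀ M′ → IsMatching k H∖T M′ → length M′ ≤ length (filter far? M)
    maximum M′ M′-matching = subst (length M′ ≤_) (sym length-filter-far) (fits M′ M′-matching)

¬¬τ≤ν*g : ∀ {d g} → Uniform k H → IsNu k H d → IsCover k (edges H) C → d ≡ 0 ⊎ IsG k d g →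
          ¬ ¬ ∃ λ t → IsTau k (edges H) t × toℚ t ℚ.≤ toℚ d * g
¬¬τ≤ν*g {k = k} {H = H} {g = g} _ ν≡0 _ (inj₁ refl) =
  contradiction (0 , ν≡0⇒τ≡0 {k = k} {H = H} ν≡0 , ℚP.≤-reflexive (sym (ℚP.*-zeroˡ g)))
¬¬τ≤ν*g {d = zero}  _ _ _ (inj₂ (() , _))
¬¬τ≤ν*g {k = k} {H = H} {d = suc j} uniform νH cover (inj₂ (g-bounds , _)) =
  ¬¬-map (λ (t , τ) → t , τ , /≤⇒≤* t j (g-bounds _ H t uniform νH τ)) (¬¬∃τ {k = k} cover)

lemma2 : ∀ (k n : ℕ) (H : Hypergraph n) → 3 ≤ k → Uniform k H →
    (M : List (Subset n)) → IsMaxMatching k H M →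
    (e : Subset n) → e ∈ M → (t : ℕ) → IsTau k (T k H e) t → t ≤ ⌈ suc k /2⌉ →
    (ν τ : ℕ) → IsNu k H ν → IsTau k (edges H) τ →
    (g : ℚ) → (ν ∸ 1 ≡ 0 ⊎ IsG k (ν ∸ 1) g) →
    toℚ τ ℚ.≤ toℚ ⌈ suc k /2⌉ + toℚ (ν ∸ 1) * g
-- Neither 3 ≤ k nor the value of ⌈ suc k /2⌉ matters: any upper bound c on τ(T_e) gives c + (ν - 1) g.
lemma2 k n H _ uniform M M-maximum e e∈M t τT t≤c ν τ νH τH@(C , cover , _) g g-spec =
  decidable-stable (_ ℚP.≤? _)
    (¬¬-map bound (¬¬τ≤ν*g {k = k} {H = H∖T} (H∖T-uniform uniform) νH∖T coverH∖T g-spec))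
  where
  open RemoveT k H e
  c : ℕ
  c = ⌈ suc k /2⌉
  νH∖T : IsNu k H∖T (ν ∸ 1)
  νH∖T = subst (λ ν → IsNu k H∖T (ν ∸ 1)) (ν-unique {k = k} {H = H} νH M-maximum)
           (ν-H∖T (All.lookup uniform (All.lookup (proj₁ (proj₁ M-maximum)) e∈M)) M-maximum e∈M)
  coverH∖T : IsCover k (edges H∖T) C
  coverH∖T = cover-⊆ {k = k} (filter-⊆ far? (edges H)) cover
  bound : (∃ λ a → IsTau k (edges H∖T) a × toℚ a ℚ.≤ toℚ (ν ∸ 1) * g) →
          toℚ τ ℚ.≤ toℚ c + toℚ (ν ∸ 1) * g
  bound (a , τH∖T , a≤) = begin
    toℚ τ                    ≤⟨ toℚ-mono-≤ (ℕP.≤-trans τ≤t+a (ℕP.+-monoˡ-≤ a t≤c)) ⟩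
    toℚ (c ℕ.+ a)            ≡⟨ toℚ-homo-+ c a ⟩
    toℚ c + toℚ a            ≤⟨ ℚP.+-monoʳ-≤ (toℚ c) a≤ ⟩
    toℚ c + toℚ (ν ∸ 1) * g  ∎
    where
    open ℚP.≤-Reasoning
    τ≤t+a : τ ≤ t ℕ.+ a
    τ≤t+a = τ-subadditive {k = k} ∈-T⊎H∖T τH τT τH∖T
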